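{- Let $m,n$ be positive integers. Every arithmetical structure on $\mathcal{P}_{m,n}$ has a unique ancestor which is a smooth arithmetical structure on some $\mathcal{P}_{m',n'}$ (with $1\le m'\le m$, $1\le n'\le n$). Moreover, for every $1\le m'\le m$, $1\le n'\le n$ and every smooth arithmetical structure $S$ on $\mathcal{P}_{m',n'}$, there are exactly $C(m,m')\,C(n,n')$ arithmetical structures on $\mathcal{P}_{m,n}$ having $S$ as an ancestor, where $C(n,k)=\frac{k}{n}\binom{2n-k-1}{n-1}$.
   Context: For positive integers $m,n$, the multigraph $\mathcal{P}_{m,n}$ has vertices $a_1,\ldots,a_m,b_1,\ldots,b_n$, a single edge between $a_i$ and $a_{i+1}$ for $1\le i<m$, a single edge between $b_i$ and $b_{i+1}$ for $1\le i<n$, and two parallel edges between $a_1$ and $b_1$. An arithmetical structure is an assignment of a positive integer label to each vertex such that the labels have gcd $1$ and each vertex's label divides the sum of its neighbors' labels counted with edge multiplicity; we write $a_i,b_i$ also for the labels. A structure is smooth if $a_1>a_2>\cdots>a_m$ and $b_1>b_2>\cdots>b_n$. Smoothing operations: (1) if $n\ge 2$ and $b_n=b_{n-1}$, delete $b_n$, obtaining a structure on $\mathcal{P}_{m,n-1}$ with other labels unchanged; (2) if $b_i=b_{i-1}+b_{i+1}$ for some $2\le i\le n-1$, delete $b_i$ and reindex $b_{i+1},\ldots,b_n$ as $b_i,\ldots,b_{n-1}$, obtaining a structure on $\mathcal{P}_{m,n-1}$; and the analogous two operations on the $a_i$. A structure $T'$ on $\mathcal{P}_{m',n'}$ is an ancestor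 of a structure $T$ on $\mathcal{P}_{m,n}$ if $T'$ is obtained from $T$ by a finite (possibly empty) sequence of smoothing operations. -}

module Defs where

open import Data.Nat using (ℕ; zero; suc; _+_; _*_; _∸_; _<_; _>_; _≤_)
open import Data.Nat.Divisibility using (_∣_)
open import Data.Nat.GCD using (gcd)
open import Data.Nat.DivMod using (_/_)
open import Data.Nat.Combinatorics using (_C_)
open import Data.List using (List; []; _∷_; _++_; foldr; length)
open import Data.List.Relation.Unary.All using (All)
open import Data.List.Relation.Unary.Linked using (Linked)
open import Data.Product using (_×_; _,_; ∃)
open import Data.Unit using (⊤)
open import Data.Empty using (⊥)
open import Relation.Binary.PropositionalEquality using (_≡_)
open import Relation.Binary.Construct.Closure.ReflexiveTransitive using (Star)

-- A labelling of P_{m,n}: the list (a_1, ..., a_m) and the list (b_1, ..., b_n).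
-- a_1 is the head of the first list, b_1 the head of the second.
Labels : Set
Labels = List ℕ × List ℕ

gcdL : List ℕ → ℕ
gcdL = foldr gcd 0

-- first element of a list, 0 if empty (sum contribution of a missing neighbour)
next : List ℕ → ℕ
next []      = 0
next (y ∷ _) = y

-- Divisibility conditions along a path x_1, x_2, ..., x_k, where `prev` is the
-- (multiplicity-weighted) contribution of the neighbours of x_1 outside the path:
-- x_i ∣ x_{i-1} + x_{i+1} (missing neighbours contribute 0, x_0 := prev).
PathOK : ℕ → List ℕ → Set
PathOK prev []       = ⊤
PathOK prev (x ∷ xs) = (x ∣ prev + next xs) × PathOK x xs

-- Arithmetical structure (on P_{m,n} with m = length as, n = length bs, both ≥ 1):
-- positive labels, gcd 1, and each label divides the sum of its neighbours'
-- labels counted with multiplicity (a_1 and b_1 are joined by two edges).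
IsArith : List ℕ → List ℕ → Set
IsArith []       _        = ⊥
IsArith (_ ∷ _)  []       = ⊥
IsArith (a ∷ as) (b ∷ bs) =
  All (0 <_) ((a ∷ as) ++ (b ∷ bs)) ×
  gcdL ((a ∷ as) ++ (b ∷ bs)) ≡ 1 ×
  PathOK (2 * b) (a ∷ as) ×
  PathOK (2 * a) (b ∷ bs)

ArithOn : ℕ → ℕ → Labels → Set
ArithOn m n (as , bs) = length as ≡ m × length bs ≡ n × IsArith as bs

Smooth : Labels → Set
Smooth (as , bs) = IsArith as bs × Linked _>_ as × Linked _>_ bs

data ArmStep : List ℕ → List ℕ → Set where
  dropLast : ∀ xs y → ArmStep (xs ++ y ∷ y ∷ []) (xs ++ y ∷ [])
  dropSum  : ∀ xs u v w ys → v ≡ u + w →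
             ArmStep (xs ++ u ∷ v ∷ w ∷ ys) (xs ++ u ∷ w ∷ ys)

data SmoothStep : Labels → Labels → Set where
  onB : ∀ as {bs bs'} → ArmStep bs bs' → SmoothStep (as , bs) (as , bs')
  onA : ∀ {as as'} bs → ArmStep as as' → SmoothStep (as , bs) (as' , bs)

Ancestor : Labels → Labels → Set
Ancestor T' T = Star SmoothStep T T'

-- C(n,k) = (k/n) * binom(2n-k-1, n-1), for n ≥ 1 (an integer; exact division).
Cat : ℕ → ℕ → ℕ
Cat zero    k = 0
Cat (suc n) k = (k * ((2 * suc n ∸ k ∸ 1) C n)) / suc n

module Submission where

-- Smoothing acts on the two arms a₁ … a_m and b₁ … b_n separately, and a step never
-- touches the first label of an arm, so the proof is a study of single arms.
--
-- * Steps preserve and reflect arithmeticity (a deleted label is a copy or a sum of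
--   surviving ones, and the neighbour sums change by multiples of the labels involved).
-- * Existence: an arm satisfying the divisibility conditions is either strictly decreasing
--   or admits a step (smooth-or-step); steps shorten the arm, so smoothing terminates.
-- * Uniqueness: a step keeps the first label u of an arm and the second label modulo u
--   (invariant); a strictly decreasing arm is determined by these two numbers, because
--   each further label is the unique residue below its predecessor forced by divisibility.
-- * Counting: the arms of length k + j smoothing down to a given arm of length k are
--   listed without repetition by  extensions j  (sorted by where they first deviate);
--   their number obeys the ballot recurrence, and the reflection formula
--   ballot = C(n, j+1) − C(n, j) turns it into the closed form C(m, k) of the statement.

open import Data.Nat using (ℕ; zero; suc; _+_; _*_; _∸_; _≤_; _<_; _>_; s≤s; z≤n)
open import Data.Nat.Properties
open import Data.Nat.Divisibility using (_∣_; divides; ∣⇒≤; ∣-refl; ∣-trans; _∣0; ∣1⇒≡1; ∣m∣n⇒∣m+n; ∣m+n∣m⇒∣n)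
open import Data.Nat.DivMod using (_/_; _%_; m*n/n≡m; n%n≡0; [m+n]%n≡m%n; m<n⇒m%n≡m)
open import Data.Nat.GCD using (gcd[m,n]∣m; gcd[m,n]∣n; gcd-greatest)
open import Data.Nat.Combinatorics using (_C_; nC1≡n; nCk≡nC[n∸k]; nCk+nC[k+1]≡[n+1]C[k+1]; k>n⇒nCk≡0)
open import Data.Nat.Tactic.RingSolver using (solve-∀)
open import Algebra.Properties.CommutativeSemigroup +-commutativeSemigroup using (x∙yz≈y∙xz; xy∙z≈y∙xz)
open import Data.List using (List; []; _∷_; _++_; length; map; cartesianProduct)
open import Data.List.Properties using (length-map; length-++; ∷-injectiveʳ)
open import Data.List.Relation.Unary.All as All using (All; []; _∷_)
import Data.List.Relation.Unary.All.Properties as All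
open import Data.List.Relation.Unary.Any using (here)
open import Data.List.Relation.Unary.AllPairs using ([]; _∷_)
open import Data.List.Relation.Unary.Linked using (Linked; []; [-]; _∷_)
open import Data.List.Relation.Unary.Unique.Propositional using (Unique)
import Data.List.Relation.Unary.Unique.Propositional.Properties as Unique
open import Data.List.Membership.Propositional using (_∈_)
open import Data.List.Membership.Propositional.Properties
  using (∈-map⁺; ∈-map⁻; ∈-++⁺ˡ; ∈-++⁺ʳ; ∈-++⁻; ∈-cartesianProduct⁺; ∈-cartesianProduct⁻)
open import Data.Product using (_×_; _,_; proj₁; proj₂; ∃; ∃₂)
open import Data.Product.Properties using (,-injectiveˡ; ,-injectiveʳ)
open import Data.Sum using (_⊎_; inj₁; inj₂)
open import Data.Unit using (tt)
open import Data.Empty using (⊥-elim)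
open import Function using (id)
open import Relation.Nullary using (¬_)
open import Relation.Binary.PropositionalEquality
open import Relation.Binary.Construct.Closure.ReflexiveTransitive using (Star; ε; _◅_; _◅◅_)
open import Defs

next-++ : ∀ xs (y : ℕ) l l' → next (xs ++ y ∷ l) ≡ next (xs ++ y ∷ l')
next-++ []       y l l' = refl
next-++ (x ∷ xs) y l l' = refl

step-cons : ∀ {t t'} x → ArmStep t t' → ArmStep (x ∷ t) (x ∷ t')
step-cons x (dropLast xs y)         = dropLast (x ∷ xs) y
step-cons x (dropSum xs u v w ys e) = dropSum (x ∷ xs) u v w ys e

steps-cons : ∀ {t t'} x → Star ArmStep t t' → Star ArmStep (x ∷ t) (x ∷ t')
steps-cons x ε        = ε
steps-cons x (s ◅ ss) = step-cons x s ◅ steps-cons x ss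

step-head : ∀ {t t'} → ArmStep t t' → ∃ λ u → ∃₂ λ r r' → t ≡ u ∷ r × t' ≡ u ∷ r'
step-head (dropLast []       y)         = y , _ , _ , refl , refl
step-head (dropLast (x ∷ xs) y)         = x , _ , _ , refl , refl
step-head (dropSum []       u v w ys e) = u , _ , _ , refl , refl
step-head (dropSum (x ∷ xs) u v w ys e) = x , _ , _ , refl , refl

step-length : ∀ {t t'} → ArmStep t t' → length t ≡ suc (length t')
step-length (dropLast []       y)         = refl
step-length (dropLast (x ∷ xs) y)         = cong suc (step-length (dropLast xs y))
step-length (dropSum []       u v w ys e) = refl
step-length (dropSum (x ∷ xs) u v w ys e) = cong suc (step-length (dropSum xs u v w ys e))

steps-length : ∀ {t t'} → Star ArmStep t t' → length t' ≤ length t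
steps-length ε        = ≤-refl
steps-length (s ◅ ss) rewrite step-length s = m≤n⇒m≤1+n (steps-length ss)

all-forward : ∀ {P : ℕ → Set} {t t'} → ArmStep t t' → All P t → All P t'
all-forward (dropLast []       y)         (py ∷ _ ∷ [])     = py ∷ []
all-forward (dropLast (x ∷ xs) y)         (px ∷ ps)         = px ∷ all-forward (dropLast xs y) ps
all-forward (dropSum []       u v w ys e) (pu ∷ pv ∷ rest)  = pu ∷ rest
all-forward (dropSum (x ∷ xs) u v w ys e) (px ∷ ps)         = px ∷ all-forward (dropSum xs u v w ys e) ps

-- ... and a property closed under addition also comes back, since a deleted label is a
-- copy or the sum of two surviving labels.
all-backward : ∀ {P : ℕ → Set} → (∀ {a b} → P a → P b → P (a + b)) →
               ∀ {t t'} → ArmStep t t' → All P t' → All P t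
all-backward plus (dropLast []       y)          (py ∷ [])        = py ∷ py ∷ []
all-backward plus (dropLast (x ∷ xs) y)          (px ∷ ps)        = px ∷ all-backward plus (dropLast xs y) ps
all-backward plus (dropSum []       u _ w ys refl) (pu ∷ pw ∷ rest) = pu ∷ plus pu pw ∷ pw ∷ rest
all-backward plus (dropSum (x ∷ xs) u v w ys e)  (px ∷ ps)        = px ∷ all-backward plus (dropSum xs u v w ys e) ps

positive-plus : ∀ {a b} → 0 < a → 0 < b → 0 < a + b
positive-plus {a} {b} 0<a _ = ≤-trans 0<a (m≤m+n a b)

-- The divisibility conditions along an arm hold before a step iff they hold after it:
-- removing y from y, y (or u + w from u, u + w, w) changes the neighbour sums by a
-- multiple of the labels concerned.
path-forward : ∀ {t t'} p → ArmStep t t' → PathOK p t → PathOK p t'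
path-forward p (dropLast [] y) (y∣p+y , _ , tt) =
  subst (y ∣_) (sym (+-identityʳ p)) (∣m+n∣m⇒∣n (subst (y ∣_) (+-comm p y) y∣p+y) ∣-refl) , tt
path-forward p (dropLast (x ∷ xs) y) (x∣ , ok) =
  subst (λ z → x ∣ p + z) (next-++ xs y (y ∷ []) []) x∣ , path-forward x (dropLast xs y) ok
path-forward p (dropSum [] u _ w ys refl) (u∣ , _ , w∣ , ok) =
  ∣m+n∣m⇒∣n (subst (u ∣_) (x∙yz≈y∙xz p u w) u∣) ∣-refl ,
  ∣m+n∣m⇒∣n (subst (w ∣_) (xy∙z≈y∙xz u w (next ys)) w∣) ∣-refl , ok
path-forward p (dropSum (x ∷ xs) u v w ys e) (x∣ , ok) =
  subst (λ z → x ∣ p + z) (next-++ xs u _ _) x∣ , path-forward x (dropSum xs u v w ys e) ok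

path-backward : ∀ {t t'} p → ArmStep t t' → PathOK p t' → PathOK p t
path-backward p (dropLast [] y) (y∣p+0 , tt) =
  subst (y ∣_) (cong (_+ y) (+-identityʳ p)) (∣m∣n⇒∣m+n y∣p+0 ∣-refl) ,
  subst (y ∣_) (sym (+-identityʳ y)) ∣-refl , tt
path-backward p (dropLast (x ∷ xs) y) (x∣ , ok) =
  subst (λ z → x ∣ p + z) (next-++ xs y [] (y ∷ [])) x∣ , path-backward x (dropLast xs y) ok
path-backward p (dropSum [] u _ w ys refl) (u∣ , w∣ , ok) =
  subst (u ∣_) (sym (x∙yz≈y∙xz p u w)) (∣m∣n⇒∣m+n ∣-refl u∣) ,
  ∣-refl ,
  subst (w ∣_) (sym (xy∙z≈y∙xz u w (next ys))) (∣m∣n⇒∣m+n ∣-refl w∣) , ok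
path-backward p (dropSum (x ∷ xs) u v w ys e) (x∣ , ok) =
  subst (λ z → x ∣ p + z) (next-++ xs u _ _) x∣ , path-backward x (dropSum xs u v w ys e) ok

gcdL-divides : ∀ X → All (gcdL X ∣_) X
gcdL-divides []      = []
gcdL-divides (x ∷ X) = gcd[m,n]∣m x (gcdL X) ∷ All.map (∣-trans (gcd[m,n]∣n x (gcdL X))) (gcdL-divides X)

gcdL-greatest : ∀ {d} X → All (d ∣_) X → d ∣ gcdL X
gcdL-greatest []      []       = _ ∣0
gcdL-greatest (x ∷ X) (d∣x ∷ ds) = gcd-greatest d∣x (gcdL-greatest X ds)

gcdL≡1-transfer : ∀ X X' → (∀ {d} → All (d ∣_) X' → All (d ∣_) X) → gcdL X ≡ 1 → gcdL X' ≡ 1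
gcdL≡1-transfer X X' common gcd≡1 =
  ∣1⇒≡1 (subst (_ ∣_) gcd≡1 (gcdL-greatest X (common (gcdL-divides X'))))

all-++ : ∀ {P : ℕ → Set} X {X' Y Y'} → (All P X → All P X') → (All P Y → All P Y') →
         All P (X ++ Y) → All P (X' ++ Y')
all-++ X f g all = All.++⁺ (f (All.++⁻ˡ X all)) (g (All.++⁻ʳ X all))

IsArithLabels : Labels → Set
IsArithLabels (as , bs) = IsArith as bs

-- A smoothing step preserves arithmeticity.  On the changed arm the neighbour of its
-- first label across the double edge is unchanged, so only the arm conditions matter.
step-preserves : ∀ {T T'} → SmoothStep T T' → IsArithLabels T → IsArithLabels T'
step-preserves (onB as st) ia with step-head st
step-preserves (onB [] st) () | _ , _ , _ , refl , refl
step-preserves (onB (a ∷ q) st) (pos , gcd≡1 , pa , pb) | b , r , r' , refl , refl =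
  all-++ (a ∷ q) id (all-forward st) pos ,
  gcdL≡1-transfer ((a ∷ q) ++ b ∷ r) _ (all-++ (a ∷ q) id (all-backward ∣m∣n⇒∣m+n st)) gcd≡1 ,
  pa , path-forward (2 * a) st pb
step-preserves (onA bs st) ia with step-head st
step-preserves (onA [] st) () | _ , _ , _ , refl , refl
step-preserves (onA (b ∷ q) st) (pos , gcd≡1 , pa , pb) | a , r , r' , refl , refl =
  all-++ (a ∷ r) (all-forward st) id pos ,
  gcdL≡1-transfer ((a ∷ r) ++ b ∷ q) _ (all-++ (a ∷ r') (all-backward ∣m∣n⇒∣m+n st) id) gcd≡1 ,
  path-forward (2 * b) st pa , pb

step-reflects : ∀ {T T'} → SmoothStep T T' → IsArithLabels T' → IsArithLabels T
step-reflects (onB as st) ia with step-head st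
step-reflects (onB [] st) () | _ , _ , _ , refl , refl
step-reflects (onB (a ∷ q) st) (pos , gcd≡1 , pa , pb) | b , r , r' , refl , refl =
  all-++ (a ∷ q) id (all-backward positive-plus st) pos ,
  gcdL≡1-transfer ((a ∷ q) ++ b ∷ r') _ (all-++ (a ∷ q) id (all-forward st)) gcd≡1 ,
  pa , path-backward (2 * a) st pb
step-reflects (onA bs st) ia with step-head st
step-reflects (onA [] st) () | _ , _ , _ , refl , refl
step-reflects (onA (b ∷ q) st) (pos , gcd≡1 , pa , pb) | a , r , r' , refl , refl =
  all-++ (a ∷ r') (all-backward positive-plus st) id pos ,
  gcdL≡1-transfer ((a ∷ r') ++ b ∷ q) _ (all-++ (a ∷ r) (all-forward st) id) gcd≡1 ,
  path-backward (2 * b) st pa , pb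

steps-preserve : ∀ {T T'} → Star SmoothStep T T' → IsArithLabels T → IsArithLabels T'
steps-preserve ε        ia = ia
steps-preserve (s ◅ ss) ia = steps-preserve ss (step-preserves s ia)

steps-reflect : ∀ {T T'} → Star SmoothStep T T' → IsArithLabels T' → IsArithLabels T
steps-reflect ε        ia = ia
steps-reflect (s ◅ ss) ia = step-reflects s (steps-reflect ss ia)

steps-split : ∀ {T T'} → Star SmoothStep T T' →
              Star ArmStep (proj₁ T) (proj₁ T') × Star ArmStep (proj₂ T) (proj₂ T')
steps-split ε                = ε , ε
steps-split (onB as st ◅ ss) = proj₁ (steps-split ss) , st ◅ proj₂ (steps-split ss)
steps-split (onA bs st ◅ ss) = st ◅ proj₁ (steps-split ss) , proj₂ (steps-split ss)

steps-combine : ∀ {as as' bs bs'} → Star ArmStep as as' → Star ArmStep bs bs' →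
                Star SmoothStep (as , bs) (as' , bs')
steps-combine {as' = as'} {bs = bs} sa sb = on-a sa ◅◅ on-b sb
  where
  on-a : ∀ {xs xs'} → Star ArmStep xs xs' → Star SmoothStep (xs , bs) (xs' , bs)
  on-a ε        = ε
  on-a (s ◅ ss) = onA bs s ◅ on-a ss
  on-b : ∀ {ys ys'} → Star ArmStep ys ys' → Star SmoothStep (as' , ys) (as' , ys')
  on-b ε        = ε
  on-b (s ◅ ss) = onB as' s ◅ on-b ss

ArmConditions : List ℕ → Set
ArmConditions t = All (0 <_) t × ∃ λ p → PathOK p t

arm-conditions : ∀ {A B} → IsArith A B → ArmConditions A × ArmConditions B
arm-conditions {a ∷ r} {b ∷ q} (pos , _ , pa , pb) =
  (All.++⁻ˡ (a ∷ r) pos , 2 * b , pa) , (All.++⁻ʳ (a ∷ r) pos , 2 * a , pb)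

next-below : ∀ x rest → 0 < x → Linked _>_ (x ∷ rest) → next rest < x
next-below x []         0<x _         = 0<x
next-below x (y ∷ rest) _   (x>y ∷ _) = x>y

-- Prepending u to a strictly decreasing arm x, rest with x ∣ u + next rest either keeps
-- it strictly decreasing or makes a step possible: the quotient (u + next rest)/x
-- is not 0 (as u > 0); if it is 1 the label x is redundant, and if it is at least 2
-- then u ≥ 2x − next rest > x.
prepend-or-step : ∀ u x rest → 0 < u → 0 < x → Linked _>_ (x ∷ rest) → x ∣ u + next rest →
                  Linked _>_ (u ∷ x ∷ rest) ⊎ ∃ (ArmStep (u ∷ x ∷ rest))
prepend-or-step u x rest 0<u _ _ (divides zero eq) = ⊥-elim (<-irrefl (sym (m+n≡0⇒m≡0 u eq)) 0<u)
prepend-or-step u x [] _ _ _ (divides 1 eq) =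
  inj₂ (u ∷ [] , subst (λ z → ArmStep (u ∷ z ∷ []) (u ∷ [])) u≡x (dropLast [] u))
  where
  u≡x : u ≡ x
  u≡x = trans (sym (+-identityʳ u)) (trans eq (+-identityʳ x))
prepend-or-step u x (w ∷ rest) _ _ _ (divides 1 eq) =
  inj₂ (u ∷ w ∷ rest , dropSum [] u x w rest (sym (trans eq (+-identityʳ x))))
prepend-or-step u x rest _ 0<x smooth (divides (suc (suc c)) eq) = inj₁ (u>x ∷ smooth)
  where
  x+x<u+x : x + x < u + x
  x+x<u+x = begin-strict
    x + x                   ≤⟨ +-monoʳ-≤ x (m≤m+n x (c * x)) ⟩
    suc (suc c) * x         ≡⟨ eq ⟨
    u + next rest           <⟨ +-monoʳ-< u (next-below x rest 0<x smooth) ⟩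
    u + x                   ∎
    where open ≤-Reasoning
  u>x : u > x
  u>x = +-cancelʳ-< x x u x+x<u+x

smooth-or-step : ∀ p t → All (0 <_) t → PathOK p t → Linked _>_ t ⊎ ∃ (ArmStep t)
smooth-or-step p [] _ _ = inj₁ []
smooth-or-step p (u ∷ xs) (0<u ∷ pos) (_ , ok) with smooth-or-step u xs pos ok
... | inj₂ (t' , st) = inj₂ (u ∷ t' , step-cons u st)
smooth-or-step p (u ∷ [])       _ _ | inj₁ _      = inj₁ [-]
smooth-or-step p (u ∷ x ∷ rest) (0<u ∷ 0<x ∷ _) (_ , x∣ , _) | inj₁ smooth =
  prepend-or-step u x rest 0<u 0<x smooth x∣

-- Smoothing an arm as long as possible ends in a strictly decreasing arm; this
-- terminates because every step shortens the arm.
reduce-arm : ∀ p t → All (0 <_) t → PathOK p t → ∃ λ t' → Star ArmStep t t' × Linked _>_ t'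
reduce-arm p t = go (length t) t ≤-refl
  where
  go : ∀ bound t → length t ≤ bound → All (0 <_) t → PathOK p t →
       ∃ λ t' → Star ArmStep t t' × Linked _>_ t'
  go bound t short pos ok with smooth-or-step p t pos ok
  ... | inj₁ smooth = t , ε , smooth
  go zero      t       short pos ok | inj₂ (t' , st) =
    ⊥-elim (<⇒≱ (subst (0 <_) (sym (step-length st)) (s≤s z≤n)) short)
  go (suc bound) t short pos ok | inj₂ (t' , st) with go bound t' shorter (all-forward st pos) (path-forward p st ok)
    where
    shorter : length t' ≤ bound
    shorter = ≤-pred (subst (_≤ suc bound) (step-length st) short)
  ... | t'' , steps , smooth = t'' , st ◅ steps , smooth

-- Smoothing keeps the first label u and the residue of the second label modulo u.
first : List ℕ → ℕ
first []      = 0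
first (x ∷ _) = x

residue : List ℕ → ℕ
residue []           = 0
residue (zero ∷ _)   = 0
residue (suc h ∷ xs) = next xs % suc h

invariant : List ℕ → ℕ × ℕ
invariant t = first t , residue t

residue-cons : ∀ x {l l'} → next l ≡ next l' → residue (x ∷ l) ≡ residue (x ∷ l')
residue-cons zero    _  = refl
residue-cons (suc h) eq = cong (_% suc h) eq

step-residue : ∀ {t t'} → ArmStep t t' → residue t ≡ residue t'
step-residue (dropLast [] zero)                   = refl
step-residue (dropLast [] (suc h))                = n%n≡0 (suc h)
step-residue (dropLast (x ∷ xs) y)                = residue-cons x (next-++ xs y _ _)
step-residue (dropSum [] zero _ w ys refl)        = refl
step-residue (dropSum [] (suc h) _ w ys refl)     =
  trans (cong (_% suc h) (+-comm (suc h) w)) ([m+n]%n≡m%n w (suc h))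
step-residue (dropSum (x ∷ xs) u v w ys e)        = residue-cons x (next-++ xs u _ _)

step-invariant : ∀ {t t'} → ArmStep t t' → invariant t ≡ invariant t'
step-invariant st with step-head st | step-residue st
... | _ , _ , _ , refl , refl | same-residue = cong (_ ,_) same-residue

steps-invariant : ∀ {t t'} → Star ArmStep t t' → invariant t ≡ invariant t'
steps-invariant ε        = refl
steps-invariant (s ◅ ss) = trans (step-invariant s) (steps-invariant ss)

multiple-below : ∀ {z c} → z ∣ c → c < z → c ≡ 0
multiple-below {c = zero}  _   _   = refl
multiple-below {c = suc c} z∣c c<z = ⊥-elim (<⇒≱ c<z (∣⇒≤ z∣c))

residue-below : ∀ {z x a b} → a ≤ b → b < z → z ∣ x + a → z ∣ x + b → a ≡ b
residue-below {z} {x} {a} a≤b b<z z∣x+a z∣x+b with m≤n⇒∃[o]m+o≡n a≤b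
... | c , refl = sym (trans (cong (a +_) c≡0) (+-identityʳ a))
  where
  c≡0 : c ≡ 0
  c≡0 = multiple-below (∣m+n∣m⇒∣n (subst (z ∣_) (sym (+-assoc x a c)) z∣x+b) z∣x+a)
                       (≤-<-trans (m≤n+m c a) b<z)

residue-unique : ∀ {z x a b} → a < z → b < z → z ∣ x + a → z ∣ x + b → a ≡ b
residue-unique {a = a} {b} a<z b<z z∣x+a z∣x+b with ≤-total a b
... | inj₁ a≤b = residue-below a≤b b<z z∣x+a z∣x+b
... | inj₂ b≤a = sym (residue-below b≤a a<z z∣x+b z∣x+a)

-- In a strictly decreasing arm x, z, … with the divisibility conditions, each label is
-- forced by its two predecessors: z ∣ x + next, with next < z.
decreasing-tail-unique : ∀ x xs ys → Linked _>_ (x ∷ xs) → Linked _>_ (x ∷ ys) →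
  All (0 <_) xs → All (0 <_) ys → PathOK x xs → PathOK x ys → next xs ≡ next ys → xs ≡ ys
decreasing-tail-unique x []       []       _ _ _            _       _ _ _ = refl
decreasing-tail-unique x []       (y ∷ ys) _ _ _            (0<y ∷ _) _ _ 0≡y = ⊥-elim (<-irrefl 0≡y 0<y)
decreasing-tail-unique x (y ∷ xs) []       _ _ (0<y ∷ _) _            _ _ y≡0 = ⊥-elim (<-irrefl (sym y≡0) 0<y)
decreasing-tail-unique x (z ∷ xs) (.z ∷ ys) (_ ∷ lx) (_ ∷ ly) (0<z ∷ px) (_ ∷ py) (z∣x+a , ox) (z∣x+b , oy) refl =
  cong (z ∷_) (decreasing-tail-unique z xs ys lx ly px py ox oy
    (residue-unique (next-below z xs 0<z lx) (next-below z ys 0<z ly) z∣x+a z∣x+b))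

smooth-arm-unique : ∀ {t t'} → ArmConditions t → ArmConditions t' → Linked _>_ t → Linked _>_ t' →
                    invariant t ≡ invariant t' → t ≡ t'
smooth-arm-unique {[]}     {[]}     _ _ _ _ _ = refl
smooth-arm-unique {[]}     {y ∷ _}  _ (0<y ∷ _ , _) _ _ same = ⊥-elim (<-irrefl (,-injectiveˡ same) 0<y)
smooth-arm-unique {x ∷ _}  {[]}     (0<x ∷ _ , _) _ _ _ same = ⊥-elim (<-irrefl (sym (,-injectiveˡ same)) 0<x)
smooth-arm-unique {zero ∷ _} (() ∷ _ , _) _ _ _ _
smooth-arm-unique {suc h ∷ xs} {y ∷ ys} (0<x ∷ px , _ , _ , ox) (_ ∷ py , _ , _ , oy) lx ly same
  with ,-injectiveˡ same
... | refl = cong (suc h ∷_) (decreasing-tail-unique (suc h) xs ys lx ly px py ox oy same-next)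
  where
  -- both second labels are below the first label, so they equal their residues
  same-next : next xs ≡ next ys
  same-next = trans (sym (m<n⇒m%n≡m (next-below (suc h) xs 0<x lx)))
                    (trans (,-injectiveʳ same) (m<n⇒m%n≡m (next-below (suc h) ys 0<x ly)))

smooth-ancestor : ∀ {T} → IsArithLabels T → ∃ λ S → Ancestor S T × Smooth S
smooth-ancestor {as , bs} ia with arm-conditions {as} {bs} ia
... | (posA , p , okA) , (posB , q , okB) with reduce-arm p as posA okA | reduce-arm q bs posB okB
... | A , sa , lkA | B , sb , lkB = (A , B) , anc , steps-preserve anc ia , lkA , lkB
  where
  anc : Ancestor (A , B) (as , bs)
  anc = steps-combine sa sb

-- Any two smooth ancestors agree, since arm by arm they share the invariant of the original arm.
smooth-ancestor-unique : ∀ {T S S'} → Ancestor S T → Ancestor S' T → Smooth S → Smooth S' → S ≡ S'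
smooth-ancestor-unique {S = A , B} {A' , B'} anc anc' (ia , lkA , lkB) (ia' , lkA' , lkB') =
  cong₂ _,_ (smooth-arm-unique (proj₁ arms) (proj₁ arms') lkA lkA' (same-invariant (proj₁ split) (proj₁ split')))
            (smooth-arm-unique (proj₂ arms) (proj₂ arms') lkB lkB' (same-invariant (proj₂ split) (proj₂ split')))
  where
  arms : ArmConditions A × ArmConditions B
  arms = arm-conditions ia
  arms' : ArmConditions A' × ArmConditions B'
  arms' = arm-conditions ia'
  split : Star ArmStep _ A × Star ArmStep _ B
  split = steps-split anc
  split' : Star ArmStep _ A' × Star ArmStep _ B'
  split' = steps-split anc'
  same-invariant : ∀ {t X Y} → Star ArmStep t X → Star ArmStep t Y → invariant X ≡ invariant Y
  same-invariant sx sy = trans (sym (steps-invariant sx)) (steps-invariant sy)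

arith-nonempty : ∀ {A B} → IsArith A B → 1 ≤ length A × 1 ≤ length B
arith-nonempty {_ ∷ _} {_ ∷ _} _ = s≤s z≤n , s≤s z≤n

ancestor-shorter : ∀ {A B A' B'} → Ancestor (A' , B') (A , B) → length A' ≤ length A × length B' ≤ length B
ancestor-shorter anc = steps-length (proj₁ (steps-split anc)) , steps-length (proj₂ (steps-split anc))

-- ballot k j counts the arms of length k + j that smooth down to a fixed arm of
-- length k (see extensions-length); the recurrence mirrors the definition of extensions.
ballot : ℕ → ℕ → ℕ
ballot k             zero    = 1
ballot zero          (suc j) = 0
ballot (suc zero)    (suc j) = ballot 2 j
ballot (suc (suc k)) (suc j) = ballot (suc k) (suc j) + ballot (suc (suc (suc k))) j

-- extensions j l lists the arms of length |l| + j that smooth down to l, sorted by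
-- their first deviation from l: either the second label is kept (and the rest is an
-- extension of the tail), or the label u + w is inserted after the first label u.
extensions : ℕ → List ℕ → List (List ℕ)
extensions zero    l              = l ∷ []
extensions (suc j) []             = []
extensions (suc j) (u ∷ [])       = extensions j (u ∷ u ∷ [])
extensions (suc j) (u ∷ w ∷ rest) =
  map (u ∷_) (extensions (suc j) (w ∷ rest)) ++ extensions j (u ∷ (u + w) ∷ w ∷ rest)

data Extension : ℕ → List ℕ → List ℕ → Set where
  base   : ∀ {l} → Extension zero l l
  double : ∀ {j u t} → Extension j (u ∷ u ∷ []) t → Extension (suc j) (u ∷ []) t
  keep   : ∀ {j u w rest s} → Extension j (w ∷ rest) s → Extension j (u ∷ w ∷ rest) (u ∷ s)
  insert : ∀ {j u w rest t} → Extension j (u ∷ (u + w) ∷ w ∷ rest) t → Extension (suc j) (u ∷ w ∷ rest) t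

extension-zero : ∀ {l t} → Extension zero l t → t ≡ l
extension-zero base     = refl
extension-zero (keep e) = cong (_ ∷_) (extension-zero e)

∈⇒Extension : ∀ j l {t} → t ∈ extensions j l → Extension j l t
∈⇒Extension zero    l              (here refl) = base
∈⇒Extension (suc j) (u ∷ [])       t∈ = double (∈⇒Extension j (u ∷ u ∷ []) t∈)
∈⇒Extension (suc j) (u ∷ w ∷ rest) t∈ with ∈-++⁻ (map (u ∷_) (extensions (suc j) (w ∷ rest))) t∈
... | inj₁ t∈kept with ∈-map⁻ (u ∷_) t∈kept
...   | s , s∈ , refl = keep (∈⇒Extension (suc j) (w ∷ rest) s∈)
∈⇒Extension (suc j) (u ∷ w ∷ rest) t∈ | inj₂ t∈inserted =
  insert (∈⇒Extension j (u ∷ (u + w) ∷ w ∷ rest) t∈inserted)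

Extension⇒∈ : ∀ {j l t} → Extension j l t → t ∈ extensions j l
Extension⇒∈ base                 = here refl
Extension⇒∈ (double e)           = Extension⇒∈ e
Extension⇒∈ {zero}  (keep e)     = here (cong (_ ∷_) (extension-zero e))
Extension⇒∈ {suc j} (keep e)     = ∈-++⁺ˡ (∈-map⁺ (_ ∷_) (Extension⇒∈ e))
Extension⇒∈ (insert {j} {u} {w} {rest} e) =
  ∈-++⁺ʳ (map (u ∷_) (extensions (suc j) (w ∷ rest))) (Extension⇒∈ e)

extension-sound : ∀ {j l t} → Extension j l t → Star ArmStep t l
extension-sound base                         = ε
extension-sound (double {u = u} e)           = extension-sound e ◅◅ (dropLast [] u ◅ ε)
extension-sound (keep {u = u} e)             = steps-cons u (extension-sound e)
extension-sound (insert {u = u} {w} {rest} e) =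
  extension-sound e ◅◅ (dropSum [] u (u + w) w rest refl ◅ ε)

extension-length : ∀ {j l t} → Extension j l t → length t ≡ length l + j
extension-length {l = l} base  = sym (+-identityʳ (length l))
extension-length (double e)    = extension-length e
extension-length (keep e)      = cong suc (extension-length e)
extension-length {suc j} {l} (insert e) = trans (extension-length e) (sym (+-suc (length l) j))

extension-head : ∀ {j w rest t} → Extension j (w ∷ rest) t → ∃ λ s → t ≡ w ∷ s
extension-head base       = _ , refl
extension-head (double e) = extension-head e
extension-head (keep e)   = _ , refl
extension-head (insert e) = extension-head e

extension-second : ∀ {j u v rest t} → Extension j (u ∷ v ∷ rest) t →
                   ∃₂ λ x s → t ≡ u ∷ x ∷ s × v ≤ x
extension-second base     = _ , _ , refl , ≤-refl
extension-second (keep e) with extension-head e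
... | _ , refl = _ , _ , refl , ≤-refl
extension-second {v = v} (insert {u = u} e) with extension-second e
... | x , s , refl , u+v≤x = x , s , refl , ≤-trans (m≤n+m v u) u+v≤x

data StepInto (u : ℕ) : List ℕ → List ℕ → Set where
  inside   : ∀ {t s} → ArmStep t s → StepInto u (u ∷ t) s
  repeated : StepInto u (u ∷ u ∷ []) []
  summed   : ∀ w ys → StepInto u (u ∷ (u + w) ∷ w ∷ ys) (w ∷ ys)

step-into : ∀ {t t' u s} → ArmStep t t' → t' ≡ u ∷ s → StepInto u t s
step-into (dropLast []       y)            refl = repeated
step-into (dropLast (x ∷ xs) y)            refl = inside (dropLast xs y)
step-into (dropSum []       u _ w ys refl) refl = summed w ys
step-into (dropSum (x ∷ xs) u v w ys e)    refl = inside (dropSum xs u v w ys e)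

no-step-into-[] : ∀ {t} → ¬ ArmStep t []
no-step-into-[] st with step-head st
... | _ , _ , _ , _ , ()

extension-closed : ∀ {j l t t'} → Extension j l t' → ArmStep t t' → Extension (suc j) l t
extension-closed {l = []} base st = ⊥-elim (no-step-into-[] st)
extension-closed {l = u ∷ []} base st with step-into st refl
... | inside st' = ⊥-elim (no-step-into-[] st')
... | repeated   = double base
extension-closed {l = u ∷ w ∷ rest} base st with step-into st refl
... | inside st'       = keep (extension-closed base st')
... | summed .w .rest  = insert base
extension-closed (double e) st = double (extension-closed e st)
extension-closed (keep e) st with step-into st refl
... | inside st' = keep (extension-closed e st')
... | repeated with extension-head e
...   | _ , ()
extension-closed (keep e) st | summed w ys with extension-head e
... | _ , refl = insert (keep (keep e))
extension-closed (insert e) st = insert (extension-closed e st)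

extension-complete : ∀ {t l} → Star ArmStep t l → ∃ λ j → Extension j l t
extension-complete ε        = zero , base
extension-complete (s ◅ ss) with extension-complete ss
... | j , e = suc j , extension-closed e s

extensions-complete : ∀ {j t l} → Star ArmStep t l → length t ≡ length l + j → t ∈ extensions j l
extensions-complete {j} {t} {l} steps |t| with extension-complete steps
... | j' , e = Extension⇒∈ (subst (λ i → Extension i l t) j'≡j e)
  where
  j'≡j : j' ≡ j
  j'≡j = +-cancelˡ-≡ (length l) j' j (trans (sym (extension-length e)) |t|)

extensions-sound : ∀ {j t l} → t ∈ extensions j l → Star ArmStep t l × length t ≡ length l + j
extensions-sound {j} {l = l} t∈ = extension-sound e , extension-length e
  where
  e : Extension j l _
  e = ∈⇒Extension j l t∈

extensions-count : ∀ j l → length (extensions j l) ≡ ballot (length l) j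
extensions-count zero    l              = refl
extensions-count (suc j) []             = refl
extensions-count (suc j) (u ∷ [])       = extensions-count j (u ∷ u ∷ [])
extensions-count (suc j) (u ∷ w ∷ rest) = begin
  length (map (u ∷_) kept ++ inserted)          ≡⟨ length-++ (map (u ∷_) kept) ⟩
  length (map (u ∷_) kept) + length inserted    ≡⟨ cong (_+ length inserted) (length-map (u ∷_) kept) ⟩
  length kept + length inserted                 ≡⟨ cong₂ _+_ (extensions-count (suc j) (w ∷ rest))
                                                             (extensions-count j (u ∷ (u + w) ∷ w ∷ rest)) ⟩
  ballot (length (u ∷ w ∷ rest)) (suc j)        ∎
  where
  open ≡-Reasoning
  kept inserted : List (List ℕ)
  kept = extensions (suc j) (w ∷ rest)
  inserted = extensions j (u ∷ (u + w) ∷ w ∷ rest)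

-- For positive labels the list has no repetitions: kept extensions continue with w,
-- inserted ones with a label ≥ u + w > w.
extensions-unique : ∀ j l → All (0 <_) l → Unique (extensions j l)
extensions-unique zero    l        _                = [] ∷ []
extensions-unique (suc j) []       _                = []
extensions-unique (suc j) (u ∷ []) (0<u ∷ [])       = extensions-unique j (u ∷ u ∷ []) (0<u ∷ 0<u ∷ [])
extensions-unique (suc j) (u ∷ w ∷ rest) (0<u ∷ 0<w ∷ pos) =
  Unique.++⁺ (Unique.map⁺ ∷-injectiveʳ (extensions-unique (suc j) (w ∷ rest) (0<w ∷ pos)))
             (extensions-unique j (u ∷ (u + w) ∷ w ∷ rest) (0<u ∷ positive-plus 0<u 0<w ∷ 0<w ∷ pos))
             disjoint
  where
  disjoint : ∀ {t} → ¬ (t ∈ map (u ∷_) (extensions (suc j) (w ∷ rest)) × t ∈ extensions j (u ∷ (u + w) ∷ w ∷ rest))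
  disjoint (t∈kept , t∈inserted) with ∈-map⁻ (u ∷_) t∈kept
  ... | s , s∈ , refl with extension-head (∈⇒Extension (suc j) (w ∷ rest) s∈)
  ...   | _ , refl with extension-second (∈⇒Extension j _ t∈inserted)
  ...     | _ , _ , refl , u+w≤w = <-irrefl refl (≤-trans (+-monoˡ-≤ w 0<u) u+w≤w)

-- Pascal's triangle given by its recurrence, so that it computes on open terms;
-- it agrees with the library's n C k.
binom : ℕ → ℕ → ℕ
binom n       zero    = 1
binom zero    (suc k) = 0
binom (suc n) (suc k) = binom n k + binom n (suc k)

binom≡C : ∀ n k → binom n k ≡ n C k
binom≡C n       zero    = refl
binom≡C zero    (suc k) = sym (k>n⇒nCk≡0 {0} {suc k} (s≤s z≤n))
binom≡C (suc n) (suc k) =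
  trans (cong₂ _+_ (binom≡C n k) (binom≡C n (suc k))) (nCk+nC[k+1]≡[n+1]C[k+1] n k)

binom-sym : ∀ {n k} → k ≤ n → binom n k ≡ binom n (n ∸ k)
binom-sym {n} {k} k≤n = trans (binom≡C n k) (trans (nCk≡nC[n∸k] k≤n) (sym (binom≡C n (n ∸ k))))

binom-one : ∀ n → binom n 1 ≡ n
binom-one n = trans (binom≡C n 1) (nC1≡n n)

binom-absorb : ∀ n k → suc k * binom (suc n) (suc k) ≡ suc n * binom n k
binom-absorb n       zero    =
  trans (+-identityʳ _) (trans (binom-one (suc n)) (sym (*-identityʳ (suc n))))
binom-absorb zero    (suc k) = *-zeroʳ (suc (suc k))
binom-absorb (suc n) (suc k) = begin
  suc (suc k) * (X + Y)                   ≡⟨ *-distribˡ-+ (suc (suc k)) X Y ⟩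
  (X + suc k * X) + suc (suc k) * Y       ≡⟨ cong₂ (λ s t → (X + s) + t)
                                                     (binom-absorb n k) (binom-absorb n (suc k)) ⟩
  (X + suc n * binom n k) + suc n * binom n (suc k)
                                          ≡⟨ +-assoc X _ _ ⟩
  X + (suc n * binom n k + suc n * binom n (suc k))
                                          ≡⟨ cong (X +_) (*-distribˡ-+ (suc n) (binom n k) (binom n (suc k))) ⟨
  X + suc n * X                           ∎
  where
  open ≡-Reasoning
  X Y : ℕ
  X = binom (suc n) (suc k)
  Y = binom (suc n) (suc (suc k))

binom-adjacent : ∀ k d → suc k * binom (k + d) (suc k) ≡ d * binom (k + d) k
binom-adjacent k d = +-cancelˡ-≡ (suc k * P) _ _ (begin
  suc k * P + suc k * binom (k + d) (suc k) ≡⟨ *-distribˡ-+ (suc k) P _ ⟨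
  suc k * binom (suc (k + d)) (suc k)       ≡⟨ binom-absorb (k + d) k ⟩
  suc (k + d) * P                           ≡⟨ *-distribʳ-+ P (suc k) d ⟩
  suc k * P + d * P                         ∎)
  where
  open ≡-Reasoning
  P : ℕ
  P = binom (k + d) k

ballot-one : ∀ k → ballot (suc k) 1 ≡ suc k
ballot-one zero    = refl
ballot-one (suc k) = trans (cong (_+ 1) (ballot-one k)) (+-comm (suc k) 1)

-- The binomial row  n = k + 2j + 2  in which ballot (k+1) (j+1) is a difference.
row : ℕ → ℕ → ℕ
row k j = suc (suc (k + (j + j)))

row-shift : ∀ k j → row (suc (suc k)) j ≡ row k (suc j)
row-shift = arithmetic
  where
  arithmetic : ∀ k j → suc (suc (suc (suc k) + (j + j))) ≡ suc (suc (k + (suc j + suc j)))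
  arithmetic = solve-∀

ballot-difference : ∀ k j → ballot (suc k) (suc j) + binom (row k j) j ≡ binom (row k j) (suc j)
ballot-difference k zero = begin
  ballot (suc k) 1 + 1    ≡⟨ cong (_+ 1) (ballot-one k) ⟩
  suc k + 1               ≡⟨ first-row k ⟩
  row k 0                 ≡⟨ binom-one (row k 0) ⟨
  binom (row k 0) 1       ∎
  where
  open ≡-Reasoning
  first-row : ∀ k → suc k + 1 ≡ suc (suc (k + 0))
  first-row = solve-∀
ballot-difference zero (suc j) rewrite +-suc j j = begin
  X + (P + Q)   ≡⟨ +-assoc X P Q ⟨
  (X + P) + Q   ≡⟨ cong (_+ Q) (ballot-difference 1 j) ⟩
  Q + Q         ≡⟨ cong (Q +_) middle-symmetry ⟨
  Q + R         ∎
  where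
  open ≡-Reasoning
  n X P Q R : ℕ
  n = row 1 j
  X = ballot 2 (suc j)
  P = binom n j
  Q = binom n (suc j)
  R = binom n (suc (suc j))
  -- row 1 j = 2j + 3 is odd, so its two middle entries agree.
  middle-symmetry : R ≡ Q
  middle-symmetry = trans (binom-sym (s≤s (s≤s (m≤n⇒m≤1+n (m≤m+n j j)))))
                          (cong (binom n) (trans (cong (_∸ j) (sym (+-suc j j))) (m+n∸m≡n j (suc j))))
ballot-difference (suc k) (suc j) = begin
  (X₁ + X₃) + (binom A j + binom A (suc j))  ≡⟨ interchange X₁ X₃ (binom A j) (binom A (suc j)) ⟩
  (X₃ + binom A j) + (X₁ + binom A (suc j))  ≡⟨ cong₂ _+_ shifted (ballot-difference k (suc j)) ⟩
  binom A (suc j) + binom A (suc (suc j))    ∎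
  where
  open ≡-Reasoning
  A X₁ X₃ : ℕ
  A = row k (suc j)
  X₁ = ballot (suc k) (suc (suc j))
  X₃ = ballot (suc (suc (suc k))) (suc j)
  shifted : X₃ + binom A j ≡ binom A (suc j)
  shifted = subst (λ n → X₃ + binom n j ≡ binom n (suc j)) (row-shift k j)
                  (ballot-difference (suc (suc k)) j)
  interchange : ∀ a b c d → (a + b) + (c + d) ≡ (b + c) + (a + d)
  interchange = solve-∀

-- Closed form:  ballot (k+1) j · (k+1+j) = (k+1) · C(k+2j, j),  by the reflection formula
-- and C(n, j+1)·(j+1) = C(n, j)·(n − j).
ballot-product : ∀ k j → ballot (suc k) j * (suc k + j) ≡ suc k * binom (k + (j + j)) j
ballot-product k zero    = trans (*-identityˡ _) (trans (+-identityʳ (suc k)) (sym (*-identityʳ (suc k))))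
ballot-product k (suc j) = begin
  X * d                                        ≡⟨ +-cancelʳ-≡ (d * P) _ _ cancelled ⟩
  suc k * Q                                    ≡⟨ cong (λ n → suc k * binom n (suc j)) row-eq ⟨
  suc k * binom (k + (suc j + suc j)) (suc j)  ∎
  where
  open ≡-Reasoning
  A X P Q d : ℕ
  A = row k j
  X = ballot (suc k) (suc j)
  P = binom A j
  Q = binom A (suc j)
  d = suc k + suc j
  row-eq : k + (suc j + suc j) ≡ A
  row-eq = row-formula k j
    where
    row-formula : ∀ k j → k + (suc j + suc j) ≡ suc (suc (k + (j + j)))
    row-formula = solve-∀
  adjacent : suc j * Q ≡ d * P
  adjacent = subst (λ n → suc j * binom n (suc j) ≡ d * binom n j) (index-eq k j) (binom-adjacent j d)
    where
    index-eq : ∀ k j → j + (suc k + suc j) ≡ suc (suc (k + (j + j)))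
    index-eq = solve-∀
  cancelled : X * d + d * P ≡ suc k * Q + d * P
  cancelled = begin
    X * d + d * P        ≡⟨ cong (X * d +_) (*-comm d P) ⟩
    X * d + P * d        ≡⟨ *-distribʳ-+ d X P ⟨
    (X + P) * d          ≡⟨ cong (_* d) (ballot-difference k j) ⟩
    Q * d                ≡⟨ *-comm Q d ⟩
    d * Q                ≡⟨ *-distribʳ-+ Q (suc k) (suc j) ⟩
    suc k * Q + suc j * Q ≡⟨ cong (suc k * Q +_) adjacent ⟩
    suc k * Q + d * P    ∎

ballot≡Cat : ∀ k j → ballot (suc k) j ≡ Cat (suc k + j) (suc k)
ballot≡Cat k j = sym (begin
  (suc k * ((2 * suc (k + j) ∸ suc k ∸ 1) C (k + j))) / suc (k + j)
    ≡⟨ cong (λ n → (suc k * (n C (k + j))) / suc (k + j)) top-eq ⟩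
  (suc k * (n C (k + j))) / suc (k + j)
    ≡⟨ cong (λ c → (suc k * c) / suc (k + j)) (trans (sym (binom≡C n (k + j))) complement) ⟩
  (suc k * binom n j) / suc (k + j)
    ≡⟨ cong (_/ suc (k + j)) (ballot-product k j) ⟨
  (ballot (suc k) j * suc (k + j)) / suc (k + j)
    ≡⟨ m*n/n≡m (ballot (suc k) j) (suc (k + j)) ⟩
  ballot (suc k) j ∎)
  where
  open ≡-Reasoning
  n : ℕ
  n = k + (j + j)
  top-eq : 2 * suc (k + j) ∸ suc k ∸ 1 ≡ n
  top-eq = trans (cong (λ t → t ∸ suc k ∸ 1) (twice-row k j)) (cong (_∸ 1) (m+n∸m≡n (suc k) (suc n)))
    where
    twice-row : ∀ k j → 2 * suc (k + j) ≡ suc k + suc (k + (j + j))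
    twice-row = solve-∀
  complement : binom n (k + j) ≡ binom n j
  complement = trans (binom-sym (subst (k + j ≤_) (+-assoc k j j) (m≤m+n (k + j) j)))
                     (cong (binom n) (trans (cong (_∸ (k + j)) (sym (+-assoc k j j))) (m+n∸m≡n (k + j) j)))

length-cartesianProduct : ∀ {A B : Set} (xs : List A) (ys : List B) →
                          length (cartesianProduct xs ys) ≡ length xs * length ys
length-cartesianProduct []       ys = refl
length-cartesianProduct (x ∷ xs) ys =
  trans (length-++ (map (x ,_) ys)) (cong₂ _+_ (length-map (x ,_) ys) (length-cartesianProduct xs ys))

ballot-Cat : ∀ {m k} → 1 ≤ k → k ≤ m → ballot k (m ∸ k) ≡ Cat m k
ballot-Cat {m} {suc k} _ k<m = trans (ballot≡Cat k (m ∸ suc k)) (cong (λ n → Cat n (suc k)) (m+[n∸m]≡n k<m))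

descendants : ℕ → ℕ → Labels → List Labels
descendants m n (A , B) = cartesianProduct (extensions (m ∸ length A) A) (extensions (n ∸ length B) B)

descendants-unique : ∀ m n {A B} → IsArith A B → Unique (descendants m n (A , B))
descendants-unique m n {A} {B} ia =
  Unique.cartesianProduct⁺ (extensions-unique (m ∸ length A) A (proj₁ (proj₁ arms)))
                           (extensions-unique (n ∸ length B) B (proj₁ (proj₂ arms)))
  where
  arms : ArmConditions A × ArmConditions B
  arms = arm-conditions ia

descendants-count : ∀ m n A B →
  length (descendants m n (A , B)) ≡ ballot (length A) (m ∸ length A) * ballot (length B) (n ∸ length B)
descendants-count m n A B =
  trans (length-cartesianProduct (extensions (m ∸ length A) A) _)
        (cong₂ _*_ (extensions-count (m ∸ length A) A) (extensions-count (n ∸ length B) B))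

descendants-sound : ∀ {m n A B T} → length A ≤ m → length B ≤ n → IsArith A B →
                    T ∈ descendants m n (A , B) → ArithOn m n T × Ancestor (A , B) T
descendants-sound {m} {n} {A} {B} {s , t} A≤m B≤n ia T∈
  with ∈-cartesianProduct⁻ (extensions (m ∸ length A) A) (extensions (n ∸ length B) B) T∈
... | s∈ , t∈ with extensions-sound s∈ | extensions-sound t∈
... | sa , |s| | sb , |t| =
  (trans |s| (m+[n∸m]≡n A≤m) , trans |t| (m+[n∸m]≡n B≤n) , steps-reflect anc ia) , anc
  where
  anc : Ancestor (A , B) (s , t)
  anc = steps-combine sa sb

descendants-complete : ∀ {m n A B T} → ArithOn m n T → Ancestor (A , B) T → T ∈ descendants m n (A , B)
descendants-complete {m} {n} {A} {B} {s , t} (|s|≡m , |t|≡n , _) anc =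
  ∈-cartesianProduct⁺ (extensions-complete sa (length-split sa |s|≡m))
                      (extensions-complete sb (length-split sb |t|≡n))
  where
  sa : Star ArmStep s A
  sa = proj₁ (steps-split anc)
  sb : Star ArmStep t B
  sb = proj₂ (steps-split anc)
  length-split : ∀ {x y k} → Star ArmStep x y → length x ≡ k → length x ≡ length y + (k ∸ length y)
  length-split {x} {y} steps refl = sym (m+[n∸m]≡n (steps-length steps))

smooth-ancestor-on-P : (m n : ℕ) → (T : Labels) → ArithOn m n T →
  ∃ λ (S : Labels) →
    Ancestor S T × Smooth S ×
    (1 ≤ length (proj₁ S)) × (length (proj₁ S) ≤ m) ×
    (1 ≤ length (proj₂ S)) × (length (proj₂ S) ≤ n) ×
    ((S' : Labels) → Ancestor S' T → Smooth S' → S' ≡ S)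
smooth-ancestor-on-P m n (as , bs) (|as|≡m , |bs|≡n , ia) with smooth-ancestor ia
... | (A , B) , anc , smooth =
  (A , B) , anc , smooth ,
  proj₁ nonempty , subst (length A ≤_) |as|≡m (proj₁ shorter) ,
  proj₂ nonempty , subst (length B ≤_) |bs|≡n (proj₂ shorter) ,
  λ S' anc' smooth' → smooth-ancestor-unique anc' anc smooth' smooth
  where
  nonempty : 1 ≤ length A × 1 ≤ length B
  nonempty = arith-nonempty (proj₁ smooth)
  shorter : length A ≤ length as × length B ≤ length bs
  shorter = ancestor-shorter anc

descendants-on-P : (m n : ℕ) →
  (m' n' : ℕ) → 1 ≤ m' → m' ≤ m → 1 ≤ n' → n' ≤ n →
  (S : Labels) → ArithOn m' n' S → Smooth S →
  ∃ λ (L : List Labels) →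
    Unique L ×
    ((T : Labels) → (T ∈ L → ArithOn m n T × Ancestor S T)
                  × (ArithOn m n T × Ancestor S T → T ∈ L)) ×
    length L ≡ Cat m m' * Cat n n'
descendants-on-P m n _ _ 1≤m' m'≤m 1≤n' n'≤n (A , B) (refl , refl , ia) _ =
  descendants m n (A , B) ,
  descendants-unique m n ia ,
  (λ T → descendants-sound m'≤m n'≤n ia , λ (arith , anc) → descendants-complete arith anc) ,
  trans (descendants-count m n A B) (cong₂ _*_ (ballot-Cat 1≤m' m'≤m) (ballot-Cat 1≤n' n'≤n))

theorem2p2 : (m n : ℕ) → 1 ≤ m → 1 ≤ n →
    ((T : Labels) → ArithOn m n T →
      ∃ λ (S : Labels) →
        Ancestor S T × Smooth S ×
        (1 ≤ length (proj₁ S)) × (length (proj₁ S) ≤ m) ×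
        (1 ≤ length (proj₂ S)) × (length (proj₂ S) ≤ n) ×
        ((S' : Labels) → Ancestor S' T → Smooth S' → S' ≡ S))
    ×
    ((m' n' : ℕ) → 1 ≤ m' → m' ≤ m → 1 ≤ n' → n' ≤ n →
      (S : Labels) → ArithOn m' n' S → Smooth S →
      ∃ λ (L : List Labels) →
        Unique L ×
        ((T : Labels) → (T ∈ L → ArithOn m n T × Ancestor S T)
                      × (ArithOn m n T × Ancestor S T → T ∈ L)) ×
        length L ≡ Cat m m' * Cat n n')
theorem2p2 m n _ _ = smooth-ancestor-on-P m n , descendants-on-P m n
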